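{- Every oriented graph $D$ on eight vertices containing no independent set of size $3$ and no transitive tournament on $3$ vertices has the following properties: (1) every vertex has total degree (in-degree plus out-degree) $4$; (2) every set of three vertices of $D$ spans at least one edge; (3) for every vertex $v$, the set of vertices other than $v$ not adjacent to $v$ induces a triangle (three pairwise adjacent vertices); (4) any set of $5$ vertices of $D$ either contains three pairwise adjacent vertices or induces an underlying undirected graph isomorphic to the $5$-cycle $C_5$; (5) any set of $6$ vertices of $D$ contains three pairwise adjacent vertices; (6) $D$ is unique up to isomorphism.
   Context: An oriented graph is a finite directed graph with no loops in which each pair of distinct vertices is joined by at most one arc. A transitive tournament on $3$ vertices consists of vertices $a,b,c$ with arcs $a\to b$, $b\to c$, $a\to c$. The underlying undirected graph is obtained by forgetting arc directions. -}

module Defs where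

open import Data.Nat using (ℕ; zero; suc; _+_)
open import Data.Bool using (Bool; true; false; _∨_; if_then_else_; T)
open import Data.Empty using (⊥)
open import Data.Fin using (Fin; zero; suc)
open import Data.List using (List; map; allFin)
open import Data.Nat.ListAction using (sum)
open import Data.Product using (Σ; _×_; ∃; ∃-syntax; _,_)
open import Data.Sum using (_⊎_)
open import Relation.Binary.PropositionalEquality using (_≡_; _≢_)
open import Relation.Nullary using (¬_)
open import Function.Definitions using (Injective)
open import Data.Fin.Permutation using (Permutation′; _⟨$⟩ʳ_)

-- An oriented graph on vertex set Fin n: an arc relation (as a Bool-valued
-- function, so it is decidable) with no loops and at most one arc between
-- any two distinct vertices (never both u→v and v→u).
record OrientedGraph (n : ℕ) : Set where
  field
    arc      : Fin n → Fin n → Bool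
    loopless : ∀ v → ¬ T (arc v v)
    oriented : ∀ u v → T (arc u v) → ¬ T (arc v u)
open OrientedGraph public

adj : ∀ {n} → OrientedGraph n → Fin n → Fin n → Bool
adj D u v = arc D u v ∨ arc D v u

Adj : ∀ {n} → OrientedGraph n → Fin n → Fin n → Set
Adj D u v = T (adj D u v)

Distinct3 : ∀ {n} → Fin n → Fin n → Fin n → Set
Distinct3 a b c = a ≢ b × b ≢ c × a ≢ c

HasIndependent3 : ∀ {n} → OrientedGraph n → Set
HasIndependent3 D = ∃[ a ] ∃[ b ] ∃[ c ]
  (Distinct3 a b c × ¬ Adj D a b × ¬ Adj D b c × ¬ Adj D a c)

HasTT3 : ∀ {n} → OrientedGraph n → Set
HasTT3 D = ∃[ a ] ∃[ b ] ∃[ c ]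
  (Distinct3 a b c × T (arc D a b) × T (arc D b c) × T (arc D a c))

Triangle : ∀ {n} → OrientedGraph n → Fin n → Fin n → Fin n → Set
Triangle D a b c = Distinct3 a b c × Adj D a b × Adj D b c × Adj D a c

outdeg indeg deg : ∀ {n} → OrientedGraph n → Fin n → ℕ
outdeg {n} D v = sum (map (λ u → if arc D v u then 1 else 0) (allFin n))
indeg  {n} D v = sum (map (λ u → if arc D u v then 1 else 0) (allFin n))
deg D v = outdeg D v + indeg D v

next5 : Fin 5 → Fin 5
next5 zero = suc zero
next5 (suc zero) = suc (suc zero)
next5 (suc (suc zero)) = suc (suc (suc zero))
next5 (suc (suc (suc zero))) = suc (suc (suc (suc zero)))
next5 (suc (suc (suc (suc zero)))) = zero

C5Adj : Fin 5 → Fin 5 → Set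
C5Adj i j = j ≡ next5 i ⊎ i ≡ next5 j

-- a k-set of vertices is given by an injective map Fin k → Fin n.
-- It contains three pairwise adjacent vertices:
ContainsTriangle : ∀ {n k} → OrientedGraph n → (Fin k → Fin n) → Set
ContainsTriangle D f = ∃[ i ] ∃[ j ] ∃[ l ] Triangle D (f i) (f j) (f l)

InducesC5 : ∀ {n} → OrientedGraph n → (Fin 5 → Fin n) → Set
InducesC5 D f = Σ (Permutation′ 5) λ σ → (∀ i j →
  (Adj D (f (σ ⟨$⟩ʳ i)) (f (σ ⟨$⟩ʳ j)) → C5Adj i j) ×
  (C5Adj i j → Adj D (f (σ ⟨$⟩ʳ i)) (f (σ ⟨$⟩ʳ j))))

Isomorphic : ∀ {n} → OrientedGraph n → OrientedGraph n → Set
Isomorphic {n} D E = Σ (Permutation′ n) λ π → (∀ u v → arc D u v ≡ arc E (π ⟨$⟩ʳ u) (π ⟨$⟩ʳ v))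

-- Two out-neighbours of a
-- vertex are never adjacent (an arc between them closes a transitive triple), and neither
-- are two in-neighbours; since every three vertices span an edge, a vertex has at most two
-- out-neighbours, at most two in-neighbours and, as every tournament on four vertices
-- contains a transitive triple, at most three non-neighbours.  With seven other vertices
-- all three bounds are attained, which fixes the neighbourhood of one vertex up to
-- relabelling.  An exhaustive search over the remaining 21 pairs, pruned as soon as a
-- transitive triple or an independent 3-set appears, then shows that D is isomorphic to
-- the circulant on ℤ₈ with i → j iff j − i ∈ {2, 3}, from which the degrees, the
-- non-neighbourhoods and uniqueness are read off.  Parts (4) and (5) only use the absence
-- of independent 3-sets: they are R(3,3) = 6 together with the uniqueness of C₅ as the
-- extremal graph, again established by exhaustive search.
module Submission where

open import Defs
open import Data.Nat using (ℕ)
open import Data.Fin using (Fin)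
open import Data.Product using (Σ; _×_; ∃; ∃-syntax; _,_)
open import Data.Sum using (_⊎_)
open import Relation.Binary.PropositionalEquality using (_≡_; _≢_)
open import Relation.Nullary using (¬_)
open import Function.Definitions using (Injective)

import Algebra.Properties.CommutativeMonoid.Sum as MonoidSum
open import Data.Bool using (Bool; true; false; _∨_; _xor_; not; if_then_else_; T)
import Data.Bool.Properties as Bool
open import Data.Bool.Properties using (T-≡; T-∧; T-∨; ∨-comm)
open import Data.Bool.ListAction using (all)
open import Data.Empty using (⊥; ⊥-elim)
open import Data.Fin using (zero; toℕ; #_)
open import Data.Fin.Properties using (_≟_; _<?_; any?; all?)
import Data.Fin.Permutation as Perm
open import Data.Fin.Permutation using (Permutation′; _⟨$⟩ʳ_; _⟨$⟩ˡ_; permutation; inverseˡ; inverseʳ)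
open import Data.List using (List; []; _∷_; map; concatMap; filter; allFin)
import Data.List.Properties as List
open import Data.List.Properties using (map-cong)
open import Data.List.Membership.Propositional using (_∈_)
open import Data.List.Relation.Unary.All using ([]; _∷_)
open import Data.List.Relation.Unary.AllPairs using ([]; _∷_)
open import Data.List.Relation.Unary.Any using (Any; here; there; satisfied)
import Data.List.Relation.Unary.Any as Any
open import Data.List.Relation.Unary.Any.Properties using (map⁺)
open import Data.List.Relation.Unary.Unique.Propositional using (Unique)
open import Data.List.Relation.Unary.Unique.DecPropositional (_≟_ {8}) using (unique?)
open import Data.Maybe using (Maybe; just; nothing)
import Data.Maybe.Properties as Maybe
open import Data.Nat using (suc; _+_; _∸_; _%_; _≡ᵇ_)
import Data.Nat.Properties as ℕ
open import Data.Nat.ListAction using (sum)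
open import Data.Product using (proj₁; proj₂)
open import Data.Sum using (inj₁; inj₂)
import Data.Sum as Sum
open import Data.Vec using (Vec; []; _∷_; lookup; replicate; tabulate; _[_]≔_)
open import Data.Vec.Properties using (lookup∘update; lookup∘update′; lookup-replicate; lookup∘tabulate)
open import Function using (_∘_; id)
open import Function.Bundles using (Equivalence; _⇔_; mk⇔)
open import Relation.Binary.PropositionalEquality using (refl; sym; trans; cong; cong₂; subst; subst₂)
open import Relation.Nullary using (Dec; yes; no)
open import Relation.Nullary.Decidable
  using (T?; ¬?; _×-dec_; _⊎-dec_; _→-dec_; ⌊_⌋; toWitness; fromWitness; fromWitnessFalse)
open import Relation.Nullary.Negation using (contradiction)

open Equivalence using (to; from)
open MonoidSum ℕ.+-0-commutativeMonoid using (sum-permute)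

¬T⇒false : ∀ {b} → ¬ T b → b ≡ false
¬T⇒false {false} _ = refl
¬T⇒false {true}  t = contradiction _ t

all-witness : ∀ {A : Set} {P : A → Set} {p : A → Bool} {xs} →
  Any P xs → T (all p xs) → ∃[ x ] P x × T (p x)
all-witness (here px) t = _ , px , proj₁ (T-∧ .to t)
all-witness {p = p} (there a) t = all-witness a (proj₂ (T-∧ {p _} .to t))

-- explores qs s is a decision procedure run by the type checker: it holds when every way
-- of deciding the questions qs in turn, starting from s, ends in a dead or an accepted
-- state.  explores-sound turns a successful run into a proof, for every starting state
-- satisfying an invariant of which branching always keeps some instance.
module Backtracking {St Q : Set} (branch : Q → St → List St)
  {Dead : Q → St → Set} (dead? : ∀ q s → Dec (Dead q s))
  {Accept : St → Set} (accept? : ∀ s → Dec (Accept s)) where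

  -- Opaque, so that a check is run once and afterwards only compared syntactically.
  opaque
    explores : List Q → St → Bool
    explores []       s = ⌊ accept? s ⌋
    explores (q ∷ qs) s = all (λ s′ → ⌊ dead? q s′ ⌋ ∨ explores qs s′) (branch q s)

  module _ (Inv : St → Set) {G : Set}
    (branch-covers : ∀ q s → Inv s → Any Inv (branch q s))
    (dead-sound : ∀ {q s} → Inv s → Dead q s → G)
    (accept-sound : ∀ {s} → Inv s → Accept s → G) where

    opaque
      unfolding explores
      explores-sound : ∀ qs s → Inv s → T (explores qs s) → G
      explores-sound []       s inv t = accept-sound inv (toWitness t)
      explores-sound (q ∷ qs) s inv t with all-witness (branch-covers q s inv) t
      ... | s′ , inv′ , t′ with T-∨ .to t′
      ...   | inj₁ dead = dead-sound inv′ (toWitness dead)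
      ...   | inj₂ rest = explores-sound qs s′ inv′ rest

open Backtracking using (explores; explores-sound)

-- Partially known relations

Partial : ℕ → Set
Partial k = Vec (Vec (Maybe Bool) k) k

infix 4 _≟ₘ_

_≟ₘ_ : (a b : Maybe Bool) → Dec (a ≡ b)
_≟ₘ_ = Maybe.≡-dec Bool._≟_

module _ {k : ℕ} where

  _[_,_] : Partial k → Fin k → Fin k → Maybe Bool
  s [ x , y ] = lookup (lookup s x) y

  unknown : Partial k
  unknown = replicate k (replicate k nothing)

  assign : Partial k → Fin k → Fin k → Bool → Bool → Partial k
  assign s u v a b = s′ [ v ]≔ (lookup s′ v [ u ]≔ just b)
    where
    s′ : Partial k
    s′ = s [ u ]≔ (lookup s u [ v ]≔ just a)

  restrict : (Fin k → Fin k → Bool) → (Fin k → Fin k → Bool) → Partial k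
  restrict R keep = tabulate λ x → tabulate λ y → if keep x y then just (R x y) else nothing

  offDiagonal : (Fin k → Fin k → Bool) → Partial k
  offDiagonal R = restrict R λ x y → not ⌊ x ≟ y ⌋

  RowAgrees : (Fin k → Bool) → Vec (Maybe Bool) k → Set
  RowAgrees P r = ∀ y {b} → lookup r y ≡ just b → P y ≡ b

  Agrees : (Fin k → Fin k → Bool) → Partial k → Set
  Agrees R s = ∀ x → RowAgrees (R x) (lookup s x)

  unknown-agrees : ∀ R → Agrees R unknown
  unknown-agrees R x y rewrite lookup-replicate x (replicate k (nothing {A = Bool}))
                             | lookup-replicate y (nothing {A = Bool}) = λ ()

  module _ {s : Partial k} {u v : Fin k} {a b : Bool} where
    private
      s′ : Partial k
      s′ = s [ u ]≔ (lookup s u [ v ]≔ just a)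

    assign-row-v : u ≢ v → lookup (assign s u v a b) v ≡ lookup s v [ u ]≔ just b
    assign-row-v u≢v = trans (lookup∘update v s′ _) (cong (_[ u ]≔ just b) (lookup∘update′ (u≢v ∘ sym) s _))

    assign-row-u : u ≢ v → lookup (assign s u v a b) u ≡ lookup s u [ v ]≔ just a
    assign-row-u u≢v = trans (lookup∘update′ u≢v s′ _) (lookup∘update u s _)

    assign-row : ∀ {x} → x ≢ u → x ≢ v → lookup (assign s u v a b) x ≡ lookup s x
    assign-row x≢u x≢v = trans (lookup∘update′ x≢v s′ _) (lookup∘update′ x≢u s _)

  update-agrees : ∀ {P r} z → RowAgrees P r → RowAgrees P (r [ z ]≔ just (P z))
  update-agrees {r = r} z ag y e with y ≟ z
  ... | yes refl = Maybe.just-injective (trans (sym (lookup∘update y r _)) e)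
  ... | no y≢z   = ag y (trans (sym (lookup∘update′ y≢z r _)) e)

  assign-agrees : ∀ {R s u v} → u ≢ v → Agrees R s → Agrees R (assign s u v (R u v) (R v u))
  assign-agrees {R} {s} {u} {v} u≢v ag x with x ≟ v | x ≟ u
  ... | yes refl | _        = subst (RowAgrees (R x)) (sym (assign-row-v {s = s} u≢v))
                                (update-agrees {r = lookup s x} u (ag x))
  ... | no x≢v   | yes refl = subst (RowAgrees (R x)) (sym (assign-row-u {s = s} x≢v))
                                (update-agrees {r = lookup s x} v (ag x))
  ... | no x≢v   | no x≢u   = subst (RowAgrees (R x)) (sym (assign-row {s = s} x≢u x≢v)) (ag x)

  module _ {R keep : Fin k → Fin k → Bool} where

    restrict-[,] : ∀ x y → restrict R keep [ x , y ] ≡ (if keep x y then just (R x y) else nothing)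
    restrict-[,] x y rewrite lookup∘tabulate (λ x → tabulate λ y → if keep x y then just (R x y) else nothing) x =
      lookup∘tabulate _ y

    restrict-agrees : ∀ {R′} → Agrees R′ (restrict R keep) → ∀ x y → T (keep x y) → R′ x y ≡ R x y
    restrict-agrees ag x y kxy with keep x y | restrict-[,] x y
    ... | true | e = ag x y e

  Refines : Partial k → Partial k → (Fin k → Fin k) → Set
  Refines s t q = ∀ x y → t [ x , y ] ≡ nothing ⊎ s [ q x , q y ] ≡ t [ x , y ]

  refines? : ∀ s t q → Dec (Refines s t q)
  refines? s t q = all? λ x → all? λ y → (t [ x , y ] ≟ₘ nothing) ⊎-dec (s [ q x , q y ] ≟ₘ t [ x , y ])

  refines-agrees : ∀ {R s t q} → Agrees R s → Refines s t q → Agrees (λ x y → R (q x) (q y)) t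
  refines-agrees {q = q} ag ref x y e with ref x y
  ... | inj₁ none = contradiction (trans (sym none) e) λ ()
  ... | inj₂ eq   = ag (q x) (q y) (trans eq e)

  refine : List (Bool × Bool) → Fin k × Fin k → Partial k → List (Partial k)
  refine choices (u , v) s with u ≟ v
  ... | yes _ = s ∷ []
  ... | no _  = map (λ (a , b) → assign s u v a b) choices

  refine-covers : ∀ {choices R u v} {s : Partial k} → (R u v , R v u) ∈ choices →
    Agrees R s → Any (Agrees R) (refine choices (u , v) s)
  refine-covers {u = u} {v} {s} c ag with u ≟ v
  ... | yes _  = here ag
  ... | no u≢v = map⁺ (Any.map (λ { refl → assign-agrees {s = s} u≢v ag }) c)

  infix 4 _⊢_⇒_ _⊢_∥_

  _⊢_⇒_ : Partial k → Fin k → Fin k → Set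
  s ⊢ x ⇒ y = s [ x , y ] ≡ just true

  _⊢_∥_ : Partial k → Fin k → Fin k → Set
  s ⊢ x ∥ y = s [ x , y ] ≡ just false × s [ y , x ] ≡ just false

  Transitive Independent : Partial k → Fin k → Fin k → Fin k → Set
  Transitive s a b c  = s ⊢ a ⇒ b × s ⊢ b ⇒ c × s ⊢ a ⇒ c
  Independent s a b c = s ⊢ a ∥ b × s ⊢ b ∥ c × s ⊢ a ∥ c × Distinct3 a b c

  -- Evaluates much faster than _≟ₘ_.
  ≟just : ∀ (m : Maybe Bool) b → Dec (m ≡ just b)
  ≟just (just true)  true  = yes refl
  ≟just (just false) false = yes refl
  ≟just (just true)  false = no λ ()
  ≟just (just false) true  = no λ ()
  ≟just nothing      _     = no λ ()

  module _ (s : Partial k) where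

    ⇒? : ∀ x y → Dec (s ⊢ x ⇒ y)
    ⇒? x y = ≟just (s [ x , y ]) true

    ∥? : ∀ x y → Dec (s ⊢ x ∥ y)
    ∥? x y = ≟just (s [ x , y ]) false ×-dec ≟just (s [ y , x ]) false

    transitive? : ∀ a b c → Dec (Transitive s a b c)
    transitive? a b c = ⇒? a b ×-dec ⇒? b c ×-dec ⇒? a c

    independent? : ∀ a b c → Dec (Independent s a b c)
    independent? a b c = ∥? a b ×-dec ∥? b c ×-dec ∥? a c ×-dec ¬? (a ≟ b) ×-dec ¬? (b ≟ c) ×-dec ¬? (a ≟ c)

  module Recorded {R : Fin k → Fin k → Bool} {s : Partial k} (ag : Agrees R s) where

    ⇒-sound : ∀ {x y} → s ⊢ x ⇒ y → T (R x y)
    ⇒-sound {x} {y} e = T-≡ .from (ag x y e)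

    ∥-sound : ∀ {x y} → s ⊢ x ∥ y → ¬ T (R x y) × ¬ T (R y x)
    ∥-sound {x} {y} (xy , yx) = subst T (ag x y xy) , subst T (ag y x yx)

-- Finite bijections

find : ∀ {n} {P : Fin (suc n) → Set} → (∀ x → Dec (P x)) → Fin (suc n)
find P? with any? P?
... | yes (x , _) = x
... | no _        = zero

-- Tabulating f makes the type checker evaluate each value of f only once.
memo : ∀ {n} {A : Set} → (Fin n → A) → Fin n → A
memo f = lookup (tabulate f)

module _ {n : ℕ} where

  inverseOf : (Fin (suc n) → Fin (suc n)) → Fin (suc n) → Fin (suc n)
  inverseOf p y = find λ x → p x ≟ y

  Invertible : (Fin (suc n) → Fin (suc n)) → Set
  Invertible p = (∀ y → p (inverseOf p y) ≡ y) × (∀ x → inverseOf p (p x) ≡ x)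

  invertible? : ∀ p → Dec (Invertible p)
  invertible? p = all? (λ y → p (inverseOf p y) ≟ y) ×-dec all? (λ x → inverseOf p (p x) ≟ x)

  invertible⇒injective : ∀ {q : Fin (suc n) → Fin (suc n)} → Invertible q → Injective _≡_ _≡_ q
  invertible⇒injective {q} (_ , left) {x} {y} e = trans (sym (left x)) (trans (cong (inverseOf q) e) (left y))

  Certified : Partial (suc n) → Partial (suc n) → (Fin (suc n) → Fin (suc n)) → Set
  Certified t s q = Invertible q × Refines s t q

  certified? : ∀ t s q → Dec (Certified t s q)
  certified? t s q = invertible? q ×-dec refines? s t q

-- Oriented graphs

adj⇒≢ : ∀ {n} (D : OrientedGraph n) {x y} → Adj D x y → x ≢ y
adj⇒≢ D {x} t refl with T-∨ .to t
... | inj₁ a = loopless D x a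
... | inj₂ a = loopless D x a

arc⇒≢ : ∀ {n} (D : OrientedGraph n) {x y} → T (arc D x y) → x ≢ y
arc⇒≢ D t = adj⇒≢ D (T-∨ .from (inj₁ t))

module _ {n : ℕ} where

  relabel : OrientedGraph (suc n) → (Fin (suc n) → Fin (suc n)) → OrientedGraph (suc n)
  relabel D q = record
    { arc      = λ u v → arc D (q u) (q v)
    ; loopless = λ v → loopless D (q v)
    ; oriented = λ u v → oriented D (q u) (q v)
    }

  relabel-iso : ∀ {D q} → Invertible q → Isomorphic D (relabel D q)
  relabel-iso {D} {q} (right , left) =
    permutation (inverseOf q) q left right , λ u v → sym (cong₂ (arc D) (right u) (right v))

  relabel-¬I₃ : ∀ {D : OrientedGraph (suc n)} {q} → Injective _≡_ _≡_ q →
    ¬ HasIndependent3 D → ¬ HasIndependent3 (relabel D q)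
  relabel-¬I₃ {q = q} inj no-I₃ (a , b , c , (ab , bc , ac) , i) =
    no-I₃ (q a , q b , q c , (ab ∘ inj , bc ∘ inj , ac ∘ inj) , i)

  relabel-¬TT₃ : ∀ {D : OrientedGraph (suc n)} {q} → Injective _≡_ _≡_ q →
    ¬ HasTT3 D → ¬ HasTT3 (relabel D q)
  relabel-¬TT₃ {q = q} inj no-TT₃ (a , b , c , (ab , bc , ac) , t) =
    no-TT₃ (q a , q b , q c , (ab ∘ inj , bc ∘ inj , ac ∘ inj) , t)

  iso-sym : ∀ {D E : OrientedGraph (suc n)} → Isomorphic D E → Isomorphic E D
  iso-sym {D} {E} (π , h) = permutation (π ⟨$⟩ˡ_) (π ⟨$⟩ʳ_) (λ _ → inverseˡ π) (λ _ → inverseʳ π) ,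
    λ x y → sym (trans (h (π ⟨$⟩ˡ x) (π ⟨$⟩ˡ y)) (cong₂ (arc E) (inverseʳ π) (inverseʳ π)))

  iso-trans : ∀ {D E F : OrientedGraph (suc n)} → Isomorphic D E → Isomorphic E F → Isomorphic D F
  iso-trans (π , h) (ρ , k) =
    permutation (λ x → ρ ⟨$⟩ʳ (π ⟨$⟩ʳ x)) (λ y → π ⟨$⟩ˡ (ρ ⟨$⟩ˡ y))
      (λ y → trans (cong (ρ ⟨$⟩ʳ_) (inverseʳ π)) (inverseʳ ρ))
      (λ x → trans (cong (π ⟨$⟩ˡ_) (inverseˡ ρ)) (inverseˡ π)) ,
    λ u v → trans (h u v) (k (π ⟨$⟩ʳ u) (π ⟨$⟩ʳ v))

  off-diagonal-iso : ∀ {D E : OrientedGraph (suc n)} → Agrees (arc D) (offDiagonal (arc E)) → Isomorphic D E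
  off-diagonal-iso {D} {E} ag = Perm.id , same
    where
    same : ∀ u v → arc D u v ≡ arc E u v
    same u v with u ≟ v
    ... | yes refl = trans (¬T⇒false (loopless D u)) (sym (¬T⇒false (loopless E u)))
    ... | no u≢v   = restrict-agrees {R = arc E} {keep = λ x y → not ⌊ x ≟ y ⌋} ag u v (fromWitnessFalse u≢v)

  certified-relabel : ∀ {D t s q} → Agrees (arc D) s → Certified t s q →
    Isomorphic D (relabel D q) × Agrees (arc (relabel D q)) t
  certified-relabel {D} {t} {s} {q} ag (inv , ref) =
    relabel-iso {D = D} {q} inv , refines-agrees {R = arc D} {s} {t} {q} ag ref

  certified-iso : ∀ {D E : OrientedGraph (suc n)} {s q} → Agrees (arc D) s →
    Certified (offDiagonal (arc E)) s q → Isomorphic D E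
  certified-iso {D} {E} {s} {q} ag c with certified-relabel {D} {offDiagonal (arc E)} {s} {q} ag c
  ... | D≅D′ , ag′ = iso-trans {D = D} {relabel D q} {E} D≅D′ (off-diagonal-iso {D = relabel D q} {E} ag′)

module Constraints {n : ℕ} (D : OrientedGraph n) (no-I₃ : ¬ HasIndependent3 D) (no-TT₃ : ¬ HasTT3 D) where

  ¬transitive : ∀ {a b c} → T (arc D a b) → T (arc D b c) → ¬ T (arc D a c)
  ¬transitive ab bc ac = no-TT₃ (_ , _ , _ , (arc⇒≢ D ab , arc⇒≢ D bc , arc⇒≢ D ac) , ab , bc , ac)

  some-pair-adjacent : ∀ {a b c} → Distinct3 a b c → Adj D a b ⊎ Adj D b c ⊎ Adj D a c
  some-pair-adjacent {a} {b} {c} d with T? (adj D a b) | T? (adj D b c) | T? (adj D a c)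
  ... | yes ab | _      | _      = inj₁ ab
  ... | no _   | yes bc | _      = inj₂ (inj₁ bc)
  ... | no _   | no _   | yes ac = inj₂ (inj₂ ac)
  ... | no ab  | no bc  | no ac  = ⊥-elim (no-I₃ (a , b , c , d , ab , bc , ac))

  out-neighbours-¬adjacent : ∀ {v x y} → T (arc D v x) → T (arc D v y) → ¬ Adj D x y
  out-neighbours-¬adjacent vx vy xy with T-∨ .to xy
  ... | inj₁ x→y = ¬transitive vx x→y vy
  ... | inj₂ y→x = ¬transitive vy y→x vx

  in-neighbours-¬adjacent : ∀ {v x y} → T (arc D x v) → T (arc D y v) → ¬ Adj D x y
  in-neighbours-¬adjacent xv yv xy with T-∨ .to xy
  ... | inj₁ x→y = ¬transitive x→y yv xv
  ... | inj₂ y→x = ¬transitive y→x xv yv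

  ¬three-out-neighbours : ∀ {v x y z} → Distinct3 x y z →
    T (arc D v x) → T (arc D v y) → ¬ T (arc D v z)
  ¬three-out-neighbours d vx vy vz with some-pair-adjacent d
  ... | inj₁ xy        = out-neighbours-¬adjacent vx vy xy
  ... | inj₂ (inj₁ yz) = out-neighbours-¬adjacent vy vz yz
  ... | inj₂ (inj₂ xz) = out-neighbours-¬adjacent vx vz xz

  ¬three-in-neighbours : ∀ {v x y z} → Distinct3 x y z →
    T (arc D x v) → T (arc D y v) → ¬ T (arc D z v)
  ¬three-in-neighbours d xv yv zv with some-pair-adjacent d
  ... | inj₁ xy        = in-neighbours-¬adjacent xv yv xy
  ... | inj₂ (inj₁ yz) = in-neighbours-¬adjacent yv zv yz
  ... | inj₂ (inj₂ xz) = in-neighbours-¬adjacent xv zv xz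

  ¬tournament₄ : ∀ {x y z w} → Adj D x y → Adj D x z → Adj D x w →
    Adj D y z → Adj D y w → ¬ Adj D z w
  ¬tournament₄ {x} {y} {z} {w} xy xz xw yz yw zw
    with T-∨ .to xy | T-∨ .to xz | T-∨ .to xw
  ... | inj₁ x→y | inj₁ x→z | _        = out-neighbours-¬adjacent x→y x→z yz
  ... | inj₁ x→y | _        | inj₁ x→w = out-neighbours-¬adjacent x→y x→w yw
  ... | _        | inj₁ x→z | inj₁ x→w = out-neighbours-¬adjacent x→z x→w zw
  ... | inj₂ y→x | inj₂ z→x | _        = in-neighbours-¬adjacent y→x z→x yz
  ... | inj₂ y→x | _        | inj₂ w→x = in-neighbours-¬adjacent y→x w→x yw
  ... | _        | inj₂ z→x | inj₂ w→x = in-neighbours-¬adjacent z→x w→x zw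

  non-neighbours-adjacent : ∀ {v x y} → Distinct3 v x y → ¬ Adj D v x → ¬ Adj D v y → Adj D x y
  non-neighbours-adjacent d vx vy with some-pair-adjacent d
  ... | inj₁ a        = ⊥-elim (vx a)
  ... | inj₂ (inj₁ a) = a
  ... | inj₂ (inj₂ a) = ⊥-elim (vy a)

  ¬four-non-neighbours : ∀ {v x y z w} → Unique (v ∷ x ∷ y ∷ z ∷ w ∷ []) →
    ¬ Adj D v x → ¬ Adj D v y → ¬ Adj D v z → ¬ Adj D v w → ⊥
  ¬four-non-neighbours ((vx ∷ vy ∷ vz ∷ vw ∷ []) ∷ (xy ∷ xz ∷ xw ∷ []) ∷ (yz ∷ yw ∷ []) ∷ (zw ∷ []) ∷ _)
    nx ny nz nw =
    ¬tournament₄ (non-neighbours-adjacent (vx , xy , vy) nx ny) (non-neighbours-adjacent (vx , xz , vz) nx nz)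
                 (non-neighbours-adjacent (vx , xw , vw) nx nw) (non-neighbours-adjacent (vy , yz , vz) ny nz)
                 (non-neighbours-adjacent (vy , yw , vw) ny nw) (non-neighbours-adjacent (vz , zw , vw) nz nw)

  module Forbidden {s : Partial n} (ag : Agrees (arc D) s) where
    open Recorded {s = s} ag

    ∥⇒¬adj : ∀ {x y} → s ⊢ x ∥ y → ¬ Adj D x y
    ∥⇒¬adj p t with T-∨ .to t | ∥-sound p
    ... | inj₁ xy | ¬xy , _ = ¬xy xy
    ... | inj₂ yx | _ , ¬yx = ¬yx yx

    ¬transitive-recorded : ∀ {a b c} → ¬ Transitive s a b c
    ¬transitive-recorded (ab , bc , ac) = ¬transitive (⇒-sound ab) (⇒-sound bc) (⇒-sound ac)

    ¬independent-recorded : ∀ {a b c} → ¬ Independent s a b c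
    ¬independent-recorded (ab , bc , ac , d) = no-I₃ (_ , _ , _ , d , ∥⇒¬adj ab , ∥⇒¬adj bc , ∥⇒¬adj ac)

-- The circulant and its completions

-- 8 + j ∸ i avoids truncated subtraction.
circulant-arc : Fin 8 → Fin 8 → Bool
circulant-arc i j = let d = (8 + toℕ j ∸ toℕ i) % 8 in (d ≡ᵇ 2) ∨ (d ≡ᵇ 3)

circulant : OrientedGraph 8
circulant = record
  { arc      = circulant-arc
  ; loopless = toWitness {a? = all? λ v → ¬? (T? (circulant-arc v v))} _
  ; oriented = toWitness {a? = all? λ u → all? λ v →
                 T? (circulant-arc u v) →-dec ¬? (T? (circulant-arc v u))} _
  }

orientations : List (Bool × Bool)
orientations = (false , false) ∷ (true , false) ∷ (false , true) ∷ []

orientation∈orientations : ∀ {n} (D : OrientedGraph n) u v → (arc D u v , arc D v u) ∈ orientations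
orientation∈orientations D u v with arc D u v in uv | arc D v u in vu
... | false | false = here refl
... | true  | false = there (here refl)
... | false | true  = there (there (here refl))
... | true  | true  = ⊥-elim (oriented D u v (T-≡ .from uv) (T-≡ .from vu))

orientations-cover : ∀ {n} (D : OrientedGraph n) q s →
  Agrees (arc D) s → Any (Agrees (arc D)) (refine orientations q s)
orientations-cover D (u , v) s = refine-covers {s = s} (orientation∈orientations D u v)

star₀ : Partial 8
star₀ = restrict circulant-arc λ x y → ⌊ x ≟ # 0 ⌋ xor ⌊ y ≟ # 0 ⌋

orderings : ∀ {A : Set} → A → A → A → List (A × A × A)
orderings a b c = (a , b , c) ∷ (a , c , b) ∷ (b , a , c) ∷ (b , c , a) ∷ (c , a , b) ∷ (c , b , a) ∷ []

Violation : Partial 8 → Fin 8 → Fin 8 → Fin 8 → Set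
Violation s a b c = Any (λ (x , y , z) → Transitive s x y z) (orderings a b c) ⊎ Independent s a b c

Contradicts : Fin 8 × Fin 8 → Partial 8 → Set
Contradicts (u , v) s = ∃[ w ] Violation s u v w

contradicts? : ∀ q s → Dec (Contradicts q s)
contradicts? (u , v) s = any? λ w →
  Any.any? (λ (x , y , z) → transitive? s x y z) (orderings u v w) ⊎-dec independent? s u v w

links : Partial 8 → Fin 8 → Fin 8 → List (Maybe Bool)
links s a u = s [ # 0 , u ] ∷ s [ u , # 0 ] ∷ s [ a , u ] ∷ s [ u , a ] ∷ []

-- The candidate isomorphism from the circulant fixes 0, sends 2 to a and every other i to
-- the vertex whose recorded arcs to 0 and a are those of i to 0 and 2: in the circulant
-- these four entries (nothing on the diagonal) tell all vertices apart.
aligned : Partial 8 → Fin 8 → Fin 8 → Fin 8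
aligned s a = memo λ i → find λ u → List.≡-dec _≟ₘ_ (links s a u) (links (offDiagonal circulant-arc) (# 2) i)

Completes : Partial 8 → Set
Completes s = Certified (offDiagonal circulant-arc) s (aligned s (# 2))
            ⊎ Certified (offDiagonal circulant-arc) s (aligned s (# 3))

completes? : ∀ s → Dec (Completes s)
completes? s = certified? target s (aligned s (# 2)) ⊎-dec certified? target s (aligned s (# 3))
  where
  target : Partial 8
  target = offDiagonal circulant-arc

pairs₂ : List (Fin 8 × Fin 8)
pairs₂ = (# 1 , # 7) ∷ (# 2 , # 3) ∷ (# 1 , # 4) ∷ (# 4 , # 7) ∷ (# 6 , # 7) ∷ (# 4 , # 6) ∷ (# 1 , # 6)
       ∷ (# 1 , # 5) ∷ (# 4 , # 5) ∷ (# 5 , # 7) ∷ (# 5 , # 6) ∷ (# 2 , # 6) ∷ (# 2 , # 5) ∷ (# 1 , # 2)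
       ∷ (# 2 , # 4) ∷ (# 2 , # 7) ∷ (# 3 , # 6) ∷ (# 1 , # 3) ∷ (# 3 , # 4) ∷ (# 3 , # 7) ∷ (# 3 , # 5) ∷ []

opaque
  unfolding explores
  completion-check : T (explores (refine orientations) contradicts? completes? pairs₂ star₀)
  completion-check = _

module _ (D : OrientedGraph 8) (no-I₃ : ¬ HasIndependent3 D) (no-TT₃ : ¬ HasTT3 D) where
  open Constraints D no-I₃ no-TT₃

  ¬contradicts : ∀ {q s} → Agrees (arc D) s → ¬ Contradicts q s
  ¬contradicts {u , v} {s} ag (_ , inj₁ t) = Forbidden.¬transitive-recorded {s} ag (proj₂ (satisfied t))
  ¬contradicts {u , v} {s} ag (_ , inj₂ i) = Forbidden.¬independent-recorded {s} ag i

  completes⇒iso : ∀ {s} → Agrees (arc D) s → Completes s → Isomorphic D circulant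
  completes⇒iso {s} ag (inj₁ c) = certified-iso {D = D} {circulant} {s} ag c
  completes⇒iso {s} ag (inj₂ c) = certified-iso {D = D} {circulant} {s} ag c

  completion : Agrees (arc D) star₀ → Isomorphic D circulant
  completion ag =
    explores-sound (refine orientations) contradicts? completes? (Agrees (arc D)) (orientations-cover D)
    (λ {q} {s} ag′ c → ⊥-elim (¬contradicts {q} {s} ag′ c)) (λ {s} → completes⇒iso {s})
    pairs₂ star₀ ag completion-check

-- Normalising the neighbourhood of vertex 0

Crowd : Partial 8 → Fin 8 → Fin 8 → Fin 8 → Fin 8 → Set
Crowd s v j x y =
    (s ⊢ v ⇒ x × s ⊢ v ⇒ y × s ⊢ v ⇒ j × Distinct3 x y j)
  ⊎ (s ⊢ x ⇒ v × s ⊢ y ⇒ v × s ⊢ j ⇒ v × Distinct3 x y j)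
  ⊎ (s ⊢ v ∥ x × s ⊢ v ∥ y × s ⊢ v ∥ j × ∃[ z ] (s ⊢ v ∥ z × Unique (v ∷ x ∷ y ∷ z ∷ j ∷ [])))

crowd? : ∀ s v j x y → Dec (Crowd s v j x y)
crowd? s v j x y =
        (⇒? s v x ×-dec ⇒? s v y ×-dec ⇒? s v j ×-dec distinct?)
  ⊎-dec (⇒? s x v ×-dec ⇒? s y v ×-dec ⇒? s j v ×-dec distinct?)
  ⊎-dec (∥? s v x ×-dec ∥? s v y ×-dec ∥? s v j ×-dec any? λ z → ∥? s v z ×-dec unique? _)
  where
  distinct? : Dec (Distinct3 x y j)
  distinct? = ¬? (x ≟ y) ×-dec ¬? (y ≟ j) ×-dec ¬? (x ≟ j)

Crowded : Fin 8 × Fin 8 → Partial 8 → Set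
Crowded (v , j) s = ∃[ x ] ∃[ y ] Crowd s v j x y

crowded? : ∀ q s → Dec (Crowded q s)
crowded? (v , j) s = any? λ x → any? λ y → crowd? s v j x y

-- In the circulant, 0 has out-neighbours 2, 3, in-neighbours 5, 6 and non-neighbours 1, 4, 7.
arrange : List (Fin 8) → List (Fin 8) → List (Fin 8) → Fin 8 → Fin 8
arrange (o₂ ∷ o₃ ∷ _) (i₅ ∷ i₆ ∷ _) (n₁ ∷ n₄ ∷ n₇ ∷ _) = lookup (# 0 ∷ n₁ ∷ o₂ ∷ o₃ ∷ n₄ ∷ i₅ ∷ i₆ ∷ n₇ ∷ [])
arrange _ _ _ = id

starLabelling : Partial 8 → Fin 8 → Fin 8
starLabelling s = arrange (filter (⇒? s (# 0)) (allFin 8)) (filter (λ x → ⇒? s x (# 0)) (allFin 8))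
                          (filter (∥? s (# 0)) (allFin 8))

normalised? : ∀ s → Dec (Certified star₀ s (starLabelling s))
normalised? s = certified? star₀ s (starLabelling s)

pairs₁ : List (Fin 8 × Fin 8)
pairs₁ = (# 0 , # 1) ∷ (# 0 , # 2) ∷ (# 0 , # 3) ∷ (# 0 , # 4) ∷ (# 0 , # 5) ∷ (# 0 , # 6) ∷ (# 0 , # 7) ∷ []

opaque
  unfolding explores
  normalisation-check : T (explores (refine orientations) crowded? normalised? pairs₁ unknown)
  normalisation-check = _

module _ (D : OrientedGraph 8) (no-I₃ : ¬ HasIndependent3 D) (no-TT₃ : ¬ HasTT3 D) where
  open Constraints D no-I₃ no-TT₃

  ¬crowded : ∀ {q s} → Agrees (arc D) s → ¬ Crowded q s
  ¬crowded {v , j} {s} ag (x , y , inj₁ (vx , vy , vj , d)) =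
    ¬three-out-neighbours d (⇒-sound vx) (⇒-sound vy) (⇒-sound vj)
    where open Recorded {s = s} ag
  ¬crowded {v , j} {s} ag (x , y , inj₂ (inj₁ (xv , yv , jv , d))) =
    ¬three-in-neighbours d (⇒-sound xv) (⇒-sound yv) (⇒-sound jv)
    where open Recorded {s = s} ag
  ¬crowded {v , j} {s} ag (x , y , inj₂ (inj₂ (vx , vy , vj , z , vz , u))) =
    ¬four-non-neighbours u (∥⇒¬adj vx) (∥⇒¬adj vy) (∥⇒¬adj vz) (∥⇒¬adj vj)
    where open Forbidden {s} ag

  normalised⇒iso : ∀ {s q} → Agrees (arc D) s → Certified star₀ s q → Isomorphic D circulant
  normalised⇒iso {s} {q} ag c with certified-relabel {D = D} {star₀} {s} {q} ag c
  ... | D≅D′ , ag′ = iso-trans {D = D} {relabel D q} {circulant} D≅D′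
         (completion (relabel D q) (relabel-¬I₃ {D = D} inj no-I₃) (relabel-¬TT₃ {D = D} inj no-TT₃) ag′)
    where
    inj : Injective _≡_ _≡_ q
    inj = invertible⇒injective (proj₁ c)

  isomorphic-to-circulant : Isomorphic D circulant
  isomorphic-to-circulant =
    explores-sound (refine orientations) crowded? normalised? (Agrees (arc D)) (orientations-cover D)
      (λ {q} {s} ag c → ⊥-elim (¬crowded {q} {s} ag c)) (λ {s} → normalised⇒iso {s})
      pairs₁ unknown (unknown-agrees (arc D)) normalisation-check

-- Five and six vertices

pairs : ∀ k → List (Fin k × Fin k)
pairs k = concatMap (λ j → map (_, j) (filter (_<? j) (allFin k))) (allFin k)

adjacencies : List (Bool × Bool)
adjacencies = (false , false) ∷ (true , true) ∷ []

-- The states here record the symmetric adjacency of the underlying graph, so a recorded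
-- transitive triple is a triangle.
Monochromatic : ∀ {k} → Fin k × Fin k → Partial k → Set
Monochromatic (u , v) s = ∃[ w ] (Transitive s u v w ⊎ Independent s u v w)

monochromatic? : ∀ {k} q (s : Partial k) → Dec (Monochromatic q s)
monochromatic? (u , v) s = any? λ w → transitive? s u v w ⊎-dec independent? s u v w

c5-arc : Fin 5 → Fin 5 → Bool
c5-arc i j = ⌊ j ≟ next5 i ⌋ ∨ ⌊ i ≟ next5 j ⌋

c5-arc-sound : ∀ {i j} → T (c5-arc i j) → C5Adj i j
c5-arc-sound {i} {j} t with T-∨ .to t
... | inj₁ e = inj₁ (toWitness {a? = j ≟ next5 i} e)
... | inj₂ e = inj₂ (toWitness {a? = i ≟ next5 j} e)

c5-arc-complete : ∀ {i j} → C5Adj i j → T (c5-arc i j)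
c5-arc-complete {i} {j} (inj₁ e) = T-∨ .from (inj₁ (fromWitness {a? = j ≟ next5 i} e))
c5-arc-complete {i} {j} (inj₂ e) = T-∨ .from (inj₂ (fromWitness {a? = i ≟ next5 j} e))

c5-irreflexive : ∀ i → c5-arc i i ≡ false
c5-irreflexive = toWitness {a? = all? λ i → c5-arc i i Bool.≟ false} _

cycleOrder : Partial 5 → Fin 5 → Fin 5
cycleOrder s = lookup (v₀ ∷ v₁ ∷ v₂ ∷ v₃ ∷ v₄ ∷ [])
  where
  step : Fin 5 → Fin 5 → Fin 5
  step cur prev = find λ x → ⇒? s cur x ×-dec ¬? (x ≟ prev)
  v₀ v₁ v₂ v₃ v₄ : Fin 5
  v₀ = # 0
  v₁ = step v₀ v₀
  v₂ = step v₁ v₀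
  v₃ = step v₂ v₁
  v₄ = step v₃ v₂

module Ramsey {n k} (D : OrientedGraph n) (no-I₃ : ¬ HasIndependent3 D)
  (f : Fin k → Fin n) (f-inj : Injective _≡_ _≡_ f) where

  R : Fin k → Fin k → Bool
  R i j = adj D (f i) (f j)

  adjacencies-cover : ∀ q s → Agrees R s → Any (Agrees R) (refine adjacencies q s)
  adjacencies-cover (u , v) s = refine-covers {s = s} (adjacency∈ (arc D (f u) (f v)) (arc D (f v) (f u)))
    where
    adjacency∈ : ∀ a b → (a ∨ b , b ∨ a) ∈ adjacencies
    adjacency∈ false false = here refl
    adjacency∈ false true  = there (here refl)
    adjacency∈ true  _     = there (here (cong (true ,_) (∨-comm _ true)))

  monochromatic-triangle : ∀ {q s} → Agrees R s → Monochromatic q s → ContainsTriangle D f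
  monochromatic-triangle {u , v} {s} ag (w , inj₁ (uv , vw , uw)) =
    u , v , w , (adj⇒≢ D uv′ , adj⇒≢ D vw′ , adj⇒≢ D uw′) , uv′ , vw′ , uw′
    where
    open Recorded {s = s} ag
    uv′ : Adj D (f u) (f v)
    uv′ = ⇒-sound uv
    vw′ : Adj D (f v) (f w)
    vw′ = ⇒-sound vw
    uw′ : Adj D (f u) (f w)
    uw′ = ⇒-sound uw
  monochromatic-triangle {u , v} {s} ag (w , inj₂ (uv , vw , uw , uv≢ , vw≢ , uw≢)) =
    ⊥-elim (no-I₃ (f u , f v , f w , (uv≢ ∘ f-inj , vw≢ ∘ f-inj , uw≢ ∘ f-inj) ,
                   proj₁ (∥-sound uv) , proj₁ (∥-sound vw) , proj₁ (∥-sound uw)))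
    where open Recorded {s = s} ag

certified-C5 : ∀ {n} {D : OrientedGraph n} (f : Fin 5 → Fin n) {s σ} →
  Agrees (λ i j → adj D (f i) (f j)) s → Certified (offDiagonal c5-arc) s σ → InducesC5 D f
certified-C5 {D = D} f {s} {σ} ag ((right , left) , ref) =
  permutation σ (inverseOf σ) right left , λ i j → (λ a → c5-arc-sound (subst T (same i j) a))
                                                 , (λ c → subst T (sym (same i j)) (c5-arc-complete c))
  where
  R : Fin 5 → Fin 5 → Bool
  R i j = adj D (f i) (f j)
  ag′ : Agrees (λ i j → R (σ i) (σ j)) (offDiagonal c5-arc)
  ag′ = refines-agrees {R = R} {s} {offDiagonal c5-arc} {σ} ag ref
  same : ∀ i j → R (σ i) (σ j) ≡ c5-arc i j
  same i j with i ≟ j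
  ... | yes refl = trans (¬T⇒false λ a → adj⇒≢ D a refl) (sym (c5-irreflexive i))
  ... | no i≢j   = restrict-agrees {R = c5-arc} {keep = λ x y → not ⌊ x ≟ y ⌋} ag′ i j (fromWitnessFalse i≢j)

pentagon? : ∀ s → Dec (Certified (offDiagonal c5-arc) s (cycleOrder s))
pentagon? s = certified? (offDiagonal c5-arc) s (cycleOrder s)

opaque
  unfolding explores
  pentagons-check : T (explores (refine adjacencies) monochromatic? pentagon? (pairs 5) unknown)
  pentagons-check = _

nothing-accepted : Partial 6 → Dec ⊥
nothing-accepted _ = no id

opaque
  unfolding explores
  hexagons-check : T (explores (refine adjacencies) monochromatic? nothing-accepted (pairs 6) unknown)
  hexagons-check = _

triangle-or-pentagon : ∀ {n} (D : OrientedGraph n) → ¬ HasIndependent3 D →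
  ∀ (f : Fin 5 → Fin n) → Injective _≡_ _≡_ f → ContainsTriangle D f ⊎ InducesC5 D f
triangle-or-pentagon D no-I₃ f f-inj =
  explores-sound (refine adjacencies) monochromatic? pentagon? (Agrees R) adjacencies-cover
    (λ {q} {s} ag m → inj₁ (monochromatic-triangle {q} {s} ag m))
    (λ {s} ag p → inj₂ (certified-C5 {D = D} f {s} ag p))
    (pairs 5) unknown (unknown-agrees R) pentagons-check
  where open Ramsey D no-I₃ f f-inj

triangle-in-six : ∀ {n} (D : OrientedGraph n) → ¬ HasIndependent3 D →
  ∀ (f : Fin 6 → Fin n) → Injective _≡_ _≡_ f → ContainsTriangle D f
triangle-in-six D no-I₃ f f-inj =
  explores-sound (refine adjacencies) monochromatic? nothing-accepted (Agrees R) adjacencies-cover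
    (λ {q} {s} ag m → monochromatic-triangle {q} {s} ag m) (λ _ c → ⊥-elim c)
    (pairs 6) unknown (unknown-agrees R) hexagons-check
  where open Ramsey D no-I₃ f f-inj

-- Invariants transported from the circulant

NonNeighboursFormTriangle : ∀ {n} → OrientedGraph n → Fin n → Set
NonNeighboursFormTriangle D v = ∃[ a ] ∃[ b ] ∃[ c ] (Triangle D a b c ×
  (∀ u → ((u ≢ v × ¬ Adj D v u) → (u ≡ a ⊎ u ≡ b ⊎ u ≡ c)) ×
         ((u ≡ a ⊎ u ≡ b ⊎ u ≡ c) → (u ≢ v × ¬ Adj D v u))))

non-neighbours-form-triangle? : ∀ {n} (D : OrientedGraph n) v → Dec (NonNeighboursFormTriangle D v)
non-neighbours-form-triangle? D v = any? λ a → any? λ b → any? λ c →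
  ((¬? (a ≟ b) ×-dec ¬? (b ≟ c) ×-dec ¬? (a ≟ c))
     ×-dec T? (adj D a b) ×-dec T? (adj D b c) ×-dec T? (adj D a c))
  ×-dec all? λ u → (non-neighbour? u →-dec listed? a b c u) ×-dec (listed? a b c u →-dec non-neighbour? u)
  where
  non-neighbour? : ∀ u → Dec (u ≢ v × ¬ Adj D v u)
  non-neighbour? u = ¬? (u ≟ v) ×-dec ¬? (T? (adj D v u))
  listed? : ∀ a b c u → Dec (u ≡ a ⊎ u ≡ b ⊎ u ≡ c)
  listed? a b c u = (u ≟ a) ⊎-dec (u ≟ b) ⊎-dec (u ≟ c)

circulant-degree : ∀ v → deg circulant v ≡ 4
circulant-degree = toWitness {a? = all? λ v → deg circulant v ℕ.≟ 4} _

circulant-non-neighbours : ∀ v → NonNeighboursFormTriangle circulant v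
circulant-non-neighbours = toWitness {a? = all? (non-neighbours-form-triangle? circulant)} _

module Invariance {n} {D E : OrientedGraph n} (iso : Isomorphic D E) where
  π : Permutation′ n
  π = proj₁ iso

  P Q : Fin n → Fin n
  P = π ⟨$⟩ʳ_
  Q = π ⟨$⟩ˡ_

  adj-P : ∀ x y → adj D x y ≡ adj E (P x) (P y)
  adj-P x y = cong₂ _∨_ (proj₂ iso x y) (proj₂ iso y x)

  Adj-Q : ∀ {x y} → Adj E x y → Adj D (Q x) (Q y)
  Adj-Q {x} {y} t = subst T (sym (adj-P (Q x) (Q y))) (subst₂ (Adj E) (sym (inverseʳ π)) (sym (inverseʳ π)) t)

  ≢-Q : ∀ {x y} → x ≢ y → Q x ≢ Q y
  ≢-Q x≢y e = x≢y (trans (sym (inverseʳ π)) (trans (cong P e) (inverseʳ π)))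

  ≡Q⇔P≡ : ∀ {u a} → u ≡ Q a ⇔ P u ≡ a
  ≡Q⇔P≡ = mk⇔ (λ { refl → inverseʳ π }) (λ { refl → sym (inverseˡ π) })

  non-neighbour⇔ : ∀ {u v} → (u ≢ v × ¬ Adj D v u) ⇔ (P u ≢ P v × ¬ Adj E (P v) (P u))
  non-neighbour⇔ {u} {v} = mk⇔
    (λ (u≢v , ¬vu) → (λ e → u≢v (trans (sym (inverseˡ π)) (trans (cong Q e) (inverseˡ π)))) ,
                     ¬vu ∘ subst T (sym (adj-P v u)))
    (λ (Pu≢Pv , ¬vu) → (Pu≢Pv ∘ cong P) , ¬vu ∘ subst T (adj-P v u))

  non-neighbours-form-triangle : ∀ {v} → NonNeighboursFormTriangle E (P v) → NonNeighboursFormTriangle D v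
  non-neighbours-form-triangle (a , b , c , ((ab , bc , ac) , tab , tbc , tac) , spec) =
    Q a , Q b , Q c , ((≢-Q ab , ≢-Q bc , ≢-Q ac) , Adj-Q tab , Adj-Q tbc , Adj-Q tac) ,
    λ u → (listed-from ∘ proj₁ (spec (P u)) ∘ non-neighbour⇔ .to)
        , (non-neighbour⇔ .from ∘ proj₂ (spec (P u)) ∘ listed-to)
    where
    listed-to : ∀ {u} → (u ≡ Q a ⊎ u ≡ Q b ⊎ u ≡ Q c) → (P u ≡ a ⊎ P u ≡ b ⊎ P u ≡ c)
    listed-to = Sum.map (≡Q⇔P≡ .to) (Sum.map (≡Q⇔P≡ .to) (≡Q⇔P≡ .to))
    listed-from : ∀ {u} → (P u ≡ a ⊎ P u ≡ b ⊎ P u ≡ c) → (u ≡ Q a ⊎ u ≡ Q b ⊎ u ≡ Q c)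
    listed-from = Sum.map (≡Q⇔P≡ .from) (Sum.map (≡Q⇔P≡ .from) (≡Q⇔P≡ .from))

indicator : Bool → ℕ
indicator b = if b then 1 else 0

degree-invariant : ∀ {D E : OrientedGraph 8} (iso : Isomorphic D E) v → deg D v ≡ deg E (proj₁ iso ⟨$⟩ʳ v)
degree-invariant {D} {E} (π , h) v = cong₂ _+_
  (trans (cong sum (map-cong (λ u → cong indicator (h v u)) (allFin 8)))
         (sym (sum-permute (λ w → indicator (arc E (π ⟨$⟩ʳ v) w)) π)))
  (trans (cong sum (map-cong (λ u → cong indicator (h u v)) (allFin 8)))
         (sym (sum-permute (λ w → indicator (arc E w (π ⟨$⟩ʳ v))) π)))

module _ {D : OrientedGraph 8} (D≅C : Isomorphic D circulant) where

  degree-four : ∀ v → deg D v ≡ 4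
  degree-four v = trans (degree-invariant {D} {circulant} D≅C v) (circulant-degree (proj₁ D≅C ⟨$⟩ʳ v))

  non-neighbours-triangle : ∀ v → NonNeighboursFormTriangle D v
  non-neighbours-triangle v = Invariance.non-neighbours-form-triangle {D = D} {circulant} D≅C {v}
                                (circulant-non-neighbours (proj₁ D≅C ⟨$⟩ʳ v))

  both-circulant : ∀ {E} → Isomorphic E circulant → Isomorphic D E
  both-circulant {E} E≅C = iso-trans {D = D} {circulant} {E} D≅C (iso-sym {D = E} {circulant} E≅C)

mainTheorem9 : (D : OrientedGraph 8) → ¬ HasIndependent3 D → ¬ HasTT3 D →
    -- (1) every vertex has total degree 4
    (∀ v → deg D v ≡ 4) ×
    -- (2) every set of three vertices spans at least one edge
    (∀ a b c → Distinct3 a b c → Adj D a b ⊎ Adj D b c ⊎ Adj D a c) ×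
    -- (3) the non-neighbours of v (other than v) induce a triangle
    (∀ v → ∃[ a ] ∃[ b ] ∃[ c ] (Triangle D a b c ×
      (∀ u → ((u ≢ v × ¬ Adj D v u) → (u ≡ a ⊎ u ≡ b ⊎ u ≡ c)) ×
             ((u ≡ a ⊎ u ≡ b ⊎ u ≡ c) → (u ≢ v × ¬ Adj D v u))))) ×
    -- (4) every 5-set contains a triangle or induces C5
    (∀ (f : Fin 5 → Fin 8) → Injective _≡_ _≡_ f →
      ContainsTriangle D f ⊎ InducesC5 D f) ×
    -- (5) every 6-set contains a triangle
    (∀ (f : Fin 6 → Fin 8) → Injective _≡_ _≡_ f → ContainsTriangle D f) ×
    -- (6) uniqueness up to isomorphism
    (∀ (E : OrientedGraph 8) → ¬ HasIndependent3 E → ¬ HasTT3 E → Isomorphic D E)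
mainTheorem9 D no-I₃ no-TT₃ =
    degree-four {D} D≅C
  , (λ a b c → some-pair-adjacent)
  , non-neighbours-triangle {D} D≅C
  , triangle-or-pentagon D no-I₃
  , triangle-in-six D no-I₃
  , (λ E no-I₃′ no-TT₃′ → both-circulant {D} D≅C {E} (isomorphic-to-circulant E no-I₃′ no-TT₃′))
  where
  open Constraints D no-I₃ no-TT₃
  D≅C : Isomorphic D circulant
  D≅C = isomorphic-to-circulant D no-I₃ no-TT₃
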